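{- For all integers $n\ge 4$, $$\sum_{j=1}^{n}\chi^{(j,1^{n-j})}\big(4\,1^{n-4}\big)^2=\frac{n^2-9n+23}{(2n-3)(2n-5)(2n-7)}\binom{2n-2}{n-1}.$$
   Context: For partitions $\lambda,\mu$ of $n$, $\chi^{\lambda}(\mu)$ is the value of the irreducible character of $S_n$ indexed by $\lambda$ on permutations of cycle type $\mu$. $(j,1^{n-j})$ is the hook shape with first row $j$ and $n-j$ rows of length $1$; $4\,1^{n-4}$ is the partition of $n$ with one part $4$ and $n-4$ parts $1$. -}

module Defs where

open import Data.Nat as ℕ using (ℕ; zero; suc; _∸_; _<ᵇ_; _≡ᵇ_)
open import Data.Integer as ℤ using (ℤ; +_; -_)
open import Data.List using (List; []; _∷_; length; replicate; map; filter; foldr; upTo)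
open import Data.Nat.ListAction using (sum)
open import Data.Bool using (Bool; true; false; if_then_else_; _∧_; not)
open import Data.Product using (_×_; _,_)

-- Partitions are lists of parts (weakly decreasing, positive).
Partition : Set
Partition = List ℕ

size : Partition → ℕ
size = sum

-- Beta-set (first-column hook lengths) of λ = (λ₁,…,λₗ):
-- βᵢ = λᵢ + (ℓ - i), i = 1..ℓ.
betaAux : ℕ → List ℕ → List ℕ
betaAux k [] = []
betaAux k (x ∷ xs) = (x ℕ.+ k) ∷ betaAux (k ∸ 1) xs

beta : Partition → List ℕ
beta λ′ = betaAux (length λ′ ∸ 1) λ′

member : ℕ → List ℕ → Bool
member x [] = false
member x (y ∷ ys) = if x ≡ᵇ y then true else member x ys

replaceBead : ℕ → ℕ → List ℕ → List ℕ
replaceBead b c [] = []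
replaceBead b c (y ∷ ys) = if b ≡ᵇ y then c ∷ ys else y ∷ replaceBead b c ys

between : ℕ → ℕ → List ℕ → ℕ
between lo hi β = length (filter (λ c → Data.Bool.T? ((lo <ᵇ c) ∧ (c <ᵇ hi))) β)
  where import Data.Bool

sgn : ℕ → ℤ
sgn zero = + 1
sgn (suc k) = - sgn k

-- Removal of a border strip (rim hook) of length r, in beta-set language:
-- move a bead b to the free position b - r; the sign is (-1)^(height),
-- the height being the number of beads strictly between b - r and b.
strips : ℕ → List ℕ → List ℕ → List (ℤ × List ℕ)
strips r β [] = []
strips r β (b ∷ bs) =
  (if (r ℕ.≤ᵇ b) ∧ not (member (b ∸ r) β)
     then (sgn (between (b ∸ r) b β) , replaceBead b (b ∸ r) β) ∷ []
     else [])
  Data.List.++ strips r β bs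
  where import Data.List

mnβ : List ℕ → List ℕ → ℤ
mnβ β [] = + 1
mnβ β (r ∷ μ) = go (strips r β β)
  where
  go : List (ℤ × List ℕ) → ℤ
  go [] = + 0
  go ((s , β′) ∷ rest) = s ℤ.* mnβ β′ μ ℤ.+ go rest

-- χ^λ(μ): value of the irreducible character of S_n indexed by λ on
-- permutations of cycle type μ (Murnaghan–Nakayama rule); 0 if |λ| ≠ |μ|.
χ : Partition → Partition → ℤ
χ λ′ μ = if size λ′ ≡ᵇ size μ then mnβ (beta λ′) μ else + 0

hook : ℕ → ℕ → Partition
hook n j = j ∷ replicate (n ∸ j) 1

fourCycle : ℕ → Partition
fourCycle n = 4 ∷ replicate (n ∸ 4) 1

hookSquareSum : ℕ → ℤ
hookSquareSum n = foldr ℤ._+_ (+ 0) (map (λ i → let c = χ (hook n (suc i)) (fourCycle n) in c ℤ.* c) (upTo n))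

{-# OPTIONS --safe #-}

-- In beta-set language the Murnaghan–Nakayama rule removes a rim hook of length r by
-- moving one bead down by r, the sign counting the beads jumped over. The beta-set of
-- the hook (i + 1, 1^k) is {i + k + 1, k, k − 1, …, 1}.
--
-- For 1-cycles only the top bead or the lowest leg bead can move, which is Pascal's rule:
-- the hook (a + 1, 1^L) has dimension C(L + a, a). For a 4-cycle the top bead moves iff
-- i ≥ 4 (removing four arm cells) and bead 4 moves to 0 iff k ≥ 4 (removing four leg
-- cells, sign (−1)³). Hence, with n = p + 5,
--   χ^(i+1, 1^k)(4 1^(n−4)) = C(p, i − 4) − C(p, i),
-- and Vandermonde's identity turns the sum of squares into 2 C(2p, p) − 2 C(2p, p + 4).
--
-- Finally C(2p, p + 4) and C(2p + 8, p + 4) are C(2p, p) times rational functions of p,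
-- obtained by telescoping the ratios of consecutive binomials; after clearing the
-- denominator (p + 1)(p + 2)(p + 3)(p + 4) the theorem is a polynomial identity.
-- The case n = 4 is a direct computation.

module Submission where

open import Defs

-- A separate module, because the statement at the end uses _+_ and _*_ on ℤ.
module HookCharacterSquares where

  open import Data.Bool using (Bool; true; false; if_then_else_; _∧_; not)
  open import Data.Fin as Fin using (Fin; toℕ)
  open import Data.Fin.Properties using (toℕ<n)
  open import Data.Integer as ℤ using (ℤ; +_; -1ℤ)
  import Data.Integer.Properties as ℤ
  import Data.Integer.Tactic.RingSolver as ℤ-Solver
  open import Data.List using (List; []; _∷_; [_]; _++_; map; foldr; applyUpTo; applyDownFrom; replicate)
  open import Data.List.Membership.Propositional using (_∈_; _∉_)
  open import Data.List.Membership.Propositional.Properties using (∈-applyDownFrom⁺; ∈-applyDownFrom⁻)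
  open import Data.List.Properties using (length-replicate)
  open import Data.List.Relation.Unary.All.Properties using (All¬⇒¬Any; ¬Any⇒All¬)
  open import Data.List.Relation.Unary.AllPairs using ([]; _∷_)
  open import Data.List.Relation.Unary.Any using (here; there)
  open import Data.List.Relation.Unary.Unique.Propositional using (Unique)
  open import Data.List.Relation.Unary.Unique.Propositional.Properties using (applyDownFrom⁺₁)
  open import Data.Nat as ℕ using (ℕ; zero; suc; _+_; _*_; _∸_; _≤ᵇ_; _≡ᵇ_; _<_; _≤_; s≤s; z<s)
  open import Data.List.Membership.DecPropositional ℕ._≟_ using (_∈?_)
  open import Data.Nat.Combinatorics using (_C_; nCn≡1; nC1≡n; nCk≡nC[n∸k]; nCk+nC[k+1]≡[n+1]C[k+1]; k>n⇒nCk≡0)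
  open import Data.Nat.Properties
  import Data.Nat.Tactic.RingSolver as ℕ-Solver
  open import Data.Product using (_×_; _,_)
  import Data.Product as Product
  open import Data.Sum using (_⊎_; inj₁; inj₂)
  import Data.Sum as Sum
  open import Function using (_∘_; case_of_; _⇔_; mk⇔; Equivalence)
  open import Relation.Binary.Definitions using (tri<; tri≈; tri>)
  open import Relation.Binary.PropositionalEquality hiding ([_])
  open import Relation.Nullary using (¬_; does; yes; no; contradiction)
  open import Relation.Nullary.Decidable using (dec-true; dec-false; _×-dec_)
  open import Algebra.Properties.Semiring.Sum +-*-semiring
  import Algebra.Properties.Semiring.Sum ℤ.+-*-semiring as ℤΣ
  open import Algebra.Properties.CommutativeSemigroup +-commutativeSemigroup using (x∙yz≈y∙xz)
  import Algebra.Properties.CommutativeSemigroup ℤ.*-commutativeSemigroup as ℤ*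

  member≡does-∈? : ∀ x xs → member x xs ≡ does (x ∈? xs)
  member≡does-∈? x []       = refl
  member≡does-∈? x (y ∷ ys) with x ≡ᵇ y
  ... | true  = refl
  ... | false = member≡does-∈? x ys

  ∈⇒member≡true : ∀ {x xs} → x ∈ xs → member x xs ≡ true
  ∈⇒member≡true {x} {xs} x∈xs = trans (member≡does-∈? x xs) (dec-true (x ∈? xs) x∈xs)

  ∉⇒member≡false : ∀ {x xs} → x ∉ xs → member x xs ≡ false
  ∉⇒member≡false {x} {xs} x∉xs = trans (member≡does-∈? x xs) (dec-false (x ∈? xs) x∉xs)

  ≡ᵇ-refl : ∀ m → (m ≡ᵇ m) ≡ true
  ≡ᵇ-refl m = dec-true (m ≟ m) refl

  ≢⇒≡ᵇ≡false : ∀ {m n} → m ≢ n → (m ≡ᵇ n) ≡ false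
  ≢⇒≡ᵇ≡false {m} {n} = dec-false (m ≟ n)

  -- Rim hooks and beads

  -- The guard and the entry of `strips`, verbatim, so that both unfold definitionally.
  movable : ℕ → List ℕ → ℕ → Bool
  movable r β b = (r ≤ᵇ b) ∧ not (member (b ∸ r) β)

  removeRimHook : ℕ → List ℕ → ℕ → ℤ × List ℕ
  removeRimHook r β b = sgn (between (b ∸ r) b β) , replaceBead b (b ∸ r) β

  strips-single : ∀ r β t {Q} → Unique Q → (∀ {b} → b ∈ Q → movable r β b ≡ (b ≡ᵇ t)) →
    strips r β Q ≡ (if member t Q then [ removeRimHook r β t ] else [])
  strips-single r β t {[]}     _              _       = refl
  strips-single r β t {b ∷ bs} (b∉bs ∷ uniq) movable⇔t
    rewrite movable⇔t (here refl) | strips-single r β t uniq (movable⇔t ∘ there) with b ≟ t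
  ... | yes refl rewrite ≡ᵇ-refl b | ∉⇒member≡false (All¬⇒¬Any b∉bs) = refl
  ... | no b≢t   rewrite ≢⇒≡ᵇ≡false b≢t | ≢⇒≡ᵇ≡false (b≢t ∘ sym) = refl

  strips-head : ∀ r t Q → strips (suc r) (suc r + t ∷ Q) (suc r + t ∷ Q) ≡
    (if member t Q then [] else [ (sgn (between t (suc r + t) (suc r + t ∷ Q)) , t ∷ Q) ])
    ++ strips (suc r) (suc r + t ∷ Q) Q
  strips-head r t Q
    rewrite dec-true (suc r ≤? suc r + t) (m≤m+n (suc r) t) | m+n∸m≡n r t
          | ≢⇒≡ᵇ≡false (m≢1+n+m t {r}) | ≡ᵇ-refl (r + t) with member t Q
  ... | true  = refl
  ... | false = refl

  between-empty : ∀ lo hi β → (∀ {c} → c ∈ β → ¬ (lo < c × c < hi)) → between lo hi β ≡ 0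
  between-empty lo hi []      _     = refl
  between-empty lo hi (c ∷ β) empty
    rewrite dec-false (lo <? c ×-dec c <? hi) (empty (here refl)) = between-empty lo hi β (empty ∘ there)

  between-adjacent : ∀ t β → between t (suc t) β ≡ 0
  between-adjacent t β = between-empty t (suc t) β λ _ (t<c , c<1+t) → <⇒≱ t<c (≤-pred c<1+t)

  mnβ-none : ∀ β r μ → strips r β β ≡ [] → mnβ β (r ∷ μ) ≡ + 0
  mnβ-none β r μ eq rewrite eq = refl

  mnβ-single : ∀ β r μ {s β₁} → strips r β β ≡ [ (s , β₁) ] → mnβ β (r ∷ μ) ≡ s ℤ.* mnβ β₁ μ
  mnβ-single β r μ eq rewrite eq = ℤ.+-identityʳ _

  mnβ-pair : ∀ β r μ {s β₁ s′ β₂} → strips r β β ≡ (s , β₁) ∷ (s′ , β₂) ∷ [] →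
    mnβ β (r ∷ μ) ≡ s ℤ.* mnβ β₁ μ ℤ.+ s′ ℤ.* mnβ β₂ μ
  mnβ-pair β r μ {s} {β₁} {s′} {β₂} eq rewrite eq =
    cong (λ x → s ℤ.* mnβ β₁ μ ℤ.+ x) (ℤ.+-identityʳ (s′ ℤ.* mnβ β₂ μ))

  module _ {b c : ℕ} where

    ∈-replaceBead⁻ : ∀ {x Q} → Unique Q → x ∈ replaceBead b c Q → x ≡ c ⊎ (x ∈ Q × x ≢ b)
    ∈-replaceBead⁻ {Q = y ∷ ys} (y∉ys ∷ uniq) x∈ with b ≟ y
    ... | yes refl rewrite ≡ᵇ-refl b = case x∈ of λ where
      (here x≡c)   → inj₁ x≡c
      (there x∈ys) → inj₂ (there x∈ys , λ { refl → All¬⇒¬Any y∉ys x∈ys })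
    ... | no b≢y rewrite ≢⇒≡ᵇ≡false b≢y = case x∈ of λ where
      (here refl) → inj₂ (here refl , b≢y ∘ sym)
      (there x∈)  → Sum.map₂ (Product.map₁ there) (∈-replaceBead⁻ uniq x∈)

    ∈-replaceBead⁺ : ∀ {x Q} → x ∈ Q → x ≢ b → x ∈ replaceBead b c Q
    ∈-replaceBead⁺ {Q = y ∷ ys} x∈ x≢b with b ≟ y
    ... | yes refl rewrite ≡ᵇ-refl b = case x∈ of λ where
      (here x≡b)   → contradiction x≡b x≢b
      (there x∈ys) → there x∈ys
    ... | no b≢y rewrite ≢⇒≡ᵇ≡false b≢y = case x∈ of λ where
      (here x≡y)   → here x≡y
      (there x∈ys) → there (∈-replaceBead⁺ x∈ys x≢b)

    ∈-replaceBead-new : ∀ {Q} → b ∈ Q → c ∈ replaceBead b c Q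
    ∈-replaceBead-new {y ∷ ys} b∈ with b ≟ y
    ... | yes refl rewrite ≡ᵇ-refl b = here refl
    ... | no b≢y rewrite ≢⇒≡ᵇ≡false b≢y = case b∈ of λ where
      (here b≡y)   → contradiction b≡y b≢y
      (there b∈ys) → there (∈-replaceBead-new b∈ys)

    replaceBead-unique : ∀ {Q} → Unique Q → c ∉ Q → Unique (replaceBead b c Q)
    replaceBead-unique {[]}     _             _   = []
    replaceBead-unique {y ∷ ys} (y∉ys ∷ uniq) c∉ with b ≟ y
    ... | yes refl rewrite ≡ᵇ-refl b = ¬Any⇒All¬ ys (c∉ ∘ there) ∷ uniq
    ... | no b≢y rewrite ≢⇒≡ᵇ≡false b≢y = ¬Any⇒All¬ _ y∉ ∷ replaceBead-unique uniq (c∉ ∘ there)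
      where
      y∉ : y ∉ replaceBead b c ys
      y∉ y∈ with ∈-replaceBead⁻ uniq y∈
      ... | inj₁ refl       = c∉ (here refl)
      ... | inj₂ (y∈ys , _) = All¬⇒¬Any y∉ys y∈ys

  -- Dimensions of hooks

  -- With top = z + L + a + 1, the list top ∷ Q is a beta-set of the hook (a + 1, 1^L)
  -- (padded with z parts 0) iff Q lists {0, …, z − 1} ∪ {z + 1, …, z + L} without repetition.
  InHookLeg : ℕ → ℕ → ℕ → Set
  InHookLeg z L x = x < z ⊎ (z < x × x ≤ z + L)

  record HookLeg (z L : ℕ) (Q : List ℕ) : Set where
    field
      unique   : Unique Q
      sound    : ∀ {x} → x ∈ Q → InHookLeg z L x
      complete : ∀ {x} → InHookLeg z L x → x ∈ Q

  open HookLeg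

  ¬InHookLeg-gap : ∀ {z L} → ¬ InHookLeg z L z
  ¬InHookLeg-gap {z} (inj₁ z<z)       = n≮n z z<z
  ¬InHookLeg-gap {z} (inj₂ (z<z , _)) = n≮n z z<z

  InHookLeg-pred : ∀ {z L b} → InHookLeg z L (suc b) → b ≢ z → InHookLeg z L b
  InHookLeg-pred {b = b} (inj₁ 1+b<z)          _   = inj₁ (<-trans (n<1+n b) 1+b<z)
  InHookLeg-pred {b = b} (inj₂ (z<1+b , 1+b≤)) b≢z =
    inj₂ (≤∧≢⇒< (≤-pred z<1+b) (b≢z ∘ sym) , ≤-trans (n≤1+n b) 1+b≤)

  InHookLeg⇒≤ : ∀ {z L x} → InHookLeg z L x → x ≤ z + L
  InHookLeg⇒≤ {z} {L} (inj₁ x<z)       = ≤-trans (<⇒≤ x<z) (m≤m+n z L)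
  InHookLeg⇒≤         (inj₂ (_ , x≤)) = x≤

  InHookLeg-slide : ∀ r z L {x} →
    InHookLeg (suc r + z) L x ⇔ (x ≡ z ⊎ (InHookLeg z (suc r + L) x × x ≢ suc r + z))
  InHookLeg-slide r z L {x} = mk⇔ to from
    where
    shift : z + (suc r + L) ≡ suc r + z + L
    shift = trans (sym (+-assoc z (suc r) L)) (cong (_+ L) (+-comm z (suc r)))
    r+z≤z+[r+L] : suc r + z ≤ z + (suc r + L)
    r+z≤z+[r+L] = ≤-trans (m≤m+n (suc r + z) L) (≤-reflexive (sym shift))
    to : InHookLeg (suc r + z) L x → x ≡ z ⊎ (InHookLeg z (suc r + L) x × x ≢ suc r + z)
    to (inj₁ x<r+z) with <-cmp x z
    ... | tri< x<z _ _ = inj₂ (inj₁ x<z , <⇒≢ x<r+z)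
    ... | tri≈ _ x≡z _ = inj₁ x≡z
    ... | tri> _ _ z<x = inj₂ (inj₂ (z<x , ≤-trans (<⇒≤ x<r+z) r+z≤z+[r+L]) , <⇒≢ x<r+z)
    to (inj₂ (r+z<x , x≤r+z+L)) =
      inj₂ (inj₂ (≤-trans (s≤s (m≤n+m z (suc r))) r+z<x , ≤-trans x≤r+z+L (≤-reflexive (sym shift)))
           , >⇒≢ r+z<x)
    from : x ≡ z ⊎ (InHookLeg z (suc r + L) x × x ≢ suc r + z) → InHookLeg (suc r + z) L x
    from (inj₁ refl) = inj₁ (m<n+m x z<s)
    from (inj₂ (inj₁ x<z , _)) = inj₁ (<-≤-trans x<z (m≤n+m z (suc r)))
    from (inj₂ (inj₂ (z<x , x≤) , x≢)) with <-cmp x (suc r + z)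
    ... | tri< x< _ _ = inj₁ x<
    ... | tri≈ _ x≡ _ = contradiction x≡ x≢
    ... | tri> _ _ x> = inj₂ (x> , ≤-trans x≤ (≤-reflexive shift))

  HookLeg-slide : ∀ r {z L Q} → HookLeg z (suc r + L) Q →
    HookLeg (suc r + z) L (replaceBead (suc r + z) z Q)
  HookLeg-slide r {z} {L} leg = record
    { unique   = replaceBead-unique (leg .unique) (¬InHookLeg-gap ∘ leg .sound)
    ; sound    = λ x∈ → Equivalence.from (InHookLeg-slide r z L)
                            (Sum.map₂ (Product.map₁ (leg .sound)) (∈-replaceBead⁻ (leg .unique) x∈))
    ; complete = λ x-in → case Equivalence.to (InHookLeg-slide r z L) x-in of λ where
        (inj₁ refl)          → ∈-replaceBead-new (leg .complete bead-in)
        (inj₂ (x-in′ , x≢)) → ∈-replaceBead⁺ (leg .complete x-in′) x≢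
    }
    where
    bead-in : InHookLeg z (suc r + L) (suc r + z)
    bead-in = inj₂ (m<n+m z z<s , ≤-trans (≤-reflexive (+-comm (suc r) z)) (+-monoʳ-≤ z (m≤m+n (suc r) L)))

  HookLeg-first : ∀ {z L Q} → HookLeg z (suc L) Q → suc z ∈ Q
  HookLeg-first {z} {L} leg =
    leg .complete (inj₂ (n<1+n z , ≤-trans (s≤s (m≤m+n z L)) (≤-reflexive (sym (+-suc z L)))))

  HookLeg-last : ∀ {z L Q} → HookLeg z (suc L) Q → z + suc L ∈ Q
  HookLeg-last {z} leg = leg .complete (inj₂ (m<m+n z z<s , ≤-refl))

  ∉-above-HookLeg : ∀ {z L Q x} → HookLeg z L Q → z + L < x → x ∉ Q
  ∉-above-HookLeg leg x> x∈ = <⇒≱ x> (InHookLeg⇒≤ (leg .sound x∈))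

  strips-1-head : ∀ t Q → strips 1 (suc t ∷ Q) (suc t ∷ Q) ≡
    (if member t Q then [] else [ (+ 1 , t ∷ Q) ]) ++ strips 1 (suc t ∷ Q) Q
  strips-1-head t Q rewrite strips-head 0 t Q | between-adjacent t (suc t ∷ Q) = refl

  module _ {z L Q top} (leg : HookLeg z L Q) (leg<top : z + L < top) where

    movable-1-leg : ∀ {b} → b ∈ Q → movable 1 (top ∷ Q) b ≡ (b ≡ᵇ suc z)
    movable-1-leg {zero}  _  = refl
    movable-1-leg {suc b} b∈ rewrite ≢⇒≡ᵇ≡false (<⇒≢ (<-trans (InHookLeg⇒≤ (leg .sound b∈)) leg<top))
      with b ≟ z
    ... | yes refl rewrite ≡ᵇ-refl b | ∉⇒member≡false (¬InHookLeg-gap ∘ leg .sound) = refl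
    ... | no b≢z   rewrite ≢⇒≡ᵇ≡false b≢z
                         | ∈⇒member≡true (leg .complete (InHookLeg-pred (leg .sound b∈) b≢z)) = refl

    strips-1-leg : strips 1 (top ∷ Q) Q ≡
      (if member (suc z) Q then [ (+ 1 , replaceBead (suc z) z (top ∷ Q)) ] else [])
    strips-1-leg rewrite strips-single 1 (top ∷ Q) (suc z) (leg .unique) movable-1-leg
                       | between-adjacent z (top ∷ Q) = refl

  mnβ-hook-dimension : ∀ L a {z Q top m} → HookLeg z L Q → m ≡ L + a → top ≡ suc (z + m) →
    mnβ (top ∷ Q) (replicate (suc m) 1) ≡ + (m C a)
  mnβ-hook-dimension zero zero {z} {Q} leg refl refl =
    trans (mnβ-single (suc (z + 0) ∷ Q) 1 [] strips-eq) (ℤ.*-identityˡ (+ 1))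
    where
    strips-eq : strips 1 (suc (z + 0) ∷ Q) (suc (z + 0) ∷ Q) ≡ [ (+ 1 , z + 0 ∷ Q) ]
    strips-eq rewrite strips-1-head (z + 0) Q | strips-1-leg leg (n<1+n (z + 0))
                    | ∉⇒member≡false (¬InHookLeg-gap ∘ subst (InHookLeg z 0) (+-identityʳ z) ∘ leg .sound)
                    | ∉⇒member≡false (∉-above-HookLeg leg (s≤s (≤-reflexive (+-identityʳ z))))
                    = refl
  mnβ-hook-dimension zero (suc a) {z} {Q} leg refl refl = begin
    mnβ (suc t ∷ Q) (replicate (2 + a) 1)        ≡⟨ mnβ-single (suc t ∷ Q) 1 (replicate (suc a) 1) strips-eq ⟩
    + 1 ℤ.* mnβ (t ∷ Q) (replicate (suc a) 1)    ≡⟨ ℤ.*-identityˡ (mnβ (t ∷ Q) (replicate (suc a) 1)) ⟩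
    mnβ (t ∷ Q) (replicate (suc a) 1)            ≡⟨ mnβ-hook-dimension 0 a leg refl (+-suc z a) ⟩
    + (a C a)                                    ≡⟨ cong +_ (trans (nCn≡1 a) (sym (nCn≡1 (suc a)))) ⟩
    + (suc a C suc a)                            ∎
    where
    open ≡-Reasoning
    t : ℕ
    t = z + suc a
    z+0<t : z + 0 < t
    z+0<t = +-monoʳ-< z z<s
    strips-eq : strips 1 (suc t ∷ Q) (suc t ∷ Q) ≡ [ (+ 1 , t ∷ Q) ]
    strips-eq rewrite strips-1-head t Q | strips-1-leg leg (m<n⇒m<1+n z+0<t)
                    | ∉⇒member≡false (∉-above-HookLeg leg z+0<t)
                    | ∉⇒member≡false (∉-above-HookLeg leg (s≤s (≤-reflexive (+-identityʳ z))))
                    = refl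
  mnβ-hook-dimension (suc L) zero {z} {Q} leg refl refl = begin
    mnβ (top ∷ Q) (1 ∷ μ)          ≡⟨ mnβ-single (top ∷ Q) 1 μ strips-eq ⟩
    + 1 ℤ.* mnβ (top ∷ Q′) μ       ≡⟨ ℤ.*-identityˡ (mnβ (top ∷ Q′) μ) ⟩
    mnβ (top ∷ Q′) μ               ≡⟨ mnβ-hook-dimension L 0 (HookLeg-slide 0 leg) refl
                                                         (cong suc (+-suc z (L + 0))) ⟩
    + 1                            ∎
    where
    open ≡-Reasoning
    t top : ℕ
    t   = z + suc (L + 0)
    top = suc t
    μ Q′ : List ℕ
    μ   = replicate (suc (L + 0)) 1
    Q′  = replaceBead (suc z) z Q
    strips-eq : strips 1 (top ∷ Q) (top ∷ Q) ≡ [ (+ 1 , top ∷ Q′) ]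
    strips-eq rewrite strips-1-head t Q | strips-1-leg leg (s≤s (+-monoʳ-≤ z (s≤s (m≤m+n L 0))))
                    | ∈⇒member≡true (subst (λ l → z + suc l ∈ Q) (sym (+-identityʳ L)) (HookLeg-last leg))
                    | ∈⇒member≡true (HookLeg-first leg)
                    | ≢⇒≡ᵇ≡false (<⇒≢ (m<m+n z (z<s {L + 0})))
                    = refl
  mnβ-hook-dimension (suc L) (suc a) {z} {Q} leg refl refl = begin
    mnβ (top ∷ Q) (1 ∷ μ)
      ≡⟨ mnβ-pair (top ∷ Q) 1 μ strips-eq ⟩
    + 1 ℤ.* mnβ (t ∷ Q) μ ℤ.+ + 1 ℤ.* mnβ (top ∷ Q′) μ
      ≡⟨ cong₂ ℤ._+_ (ℤ.*-identityˡ (mnβ (t ∷ Q) μ)) (ℤ.*-identityˡ (mnβ (top ∷ Q′) μ)) ⟩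
    mnβ (t ∷ Q) μ ℤ.+ mnβ (top ∷ Q′) μ
      ≡⟨ cong₂ ℤ._+_ arm-removed leg-removed ⟩
    + (m C a) ℤ.+ + (m C suc a)
      ≡⟨ ℤ.pos-+ (m C a) (m C suc a) ⟨
    + (m C a + m C suc a)
      ≡⟨ cong +_ (nCk+nC[k+1]≡[n+1]C[k+1] m a) ⟩
    + (suc m C suc a)
      ∎
    where
    open ≡-Reasoning
    m t top : ℕ
    m   = L + suc a
    t   = z + suc m
    top = suc t
    μ Q′ : List ℕ
    μ   = replicate (suc m) 1
    Q′  = replaceBead (suc z) z Q
    arm-removed : mnβ (t ∷ Q) μ ≡ + (m C a)
    arm-removed = mnβ-hook-dimension (suc L) a leg (+-suc L a) (+-suc z m)
    leg-removed : mnβ (top ∷ Q′) μ ≡ + (m C suc a)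
    leg-removed = mnβ-hook-dimension L (suc a) (HookLeg-slide 0 leg) refl (cong suc (+-suc z m))
    strips-eq : strips 1 (top ∷ Q) (top ∷ Q) ≡ (+ 1 , t ∷ Q) ∷ (+ 1 , top ∷ Q′) ∷ []
    strips-eq rewrite strips-1-head t Q | strips-1-leg leg (s≤s (+-monoʳ-≤ z (s≤s (m≤m+n L (suc a)))))
                    | ∉⇒member≡false (∉-above-HookLeg {x = t} leg (+-monoʳ-< z (s≤s (m<m+n L z<s))))
                    | ∈⇒member≡true (HookLeg-first leg)
                    | ≢⇒≡ᵇ≡false (<⇒≢ (m<m+n z (z<s {m})))
                    = refl

  -- Hooks at a 4-cycle

  legBeads : ℕ → List ℕ
  legBeads = applyDownFrom suc

  legBeads-HookLeg : ∀ k → HookLeg 0 k (legBeads k)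
  legBeads-HookLeg k = record
    { unique   = applyDownFrom⁺₁ suc k (λ j<i _ → >⇒≢ (s≤s j<i))
    ; sound    = λ x∈ → case ∈-applyDownFrom⁻ suc x∈ of λ { (i , i<k , refl) → inj₂ (z<s , i<k) }
    ; complete = λ { (inj₂ (s≤s _ , x≤k)) → ∈-applyDownFrom⁺ suc x≤k }
    }

  ∈-legBeads⁺ : ∀ {x k} → 0 < x → x ≤ k → x ∈ legBeads k
  ∈-legBeads⁺ 0<x x≤k = legBeads-HookLeg _ .complete (inj₂ (0<x , x≤k))

  ∉-legBeads : ∀ {x k} → k < x → x ∉ legBeads k
  ∉-legBeads = ∉-above-HookLeg (legBeads-HookLeg _)

  strips-4-legBeads : ∀ n k → strips 4 (5 + n ∷ legBeads k) (legBeads k) ≡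
    (if member 4 (legBeads k)
       then [ (sgn (between 0 4 (legBeads k)) , 5 + n ∷ replaceBead 4 0 (legBeads k)) ] else [])
  strips-4-legBeads n k = strips-single 4 (5 + n ∷ legBeads k) 4 (legBeads-HookLeg k .unique) movable-4
    where
    movable-4 : ∀ {b} → b ∈ legBeads k → movable 4 (5 + n ∷ legBeads k) b ≡ (b ≡ᵇ 4)
    movable-4 {0}                           _  = refl
    movable-4 {1}                           _  = refl
    movable-4 {2}                           _  = refl
    movable-4 {3}                           _  = refl
    movable-4 {4}                           _  =
      cong not (∉⇒member≡false (¬InHookLeg-gap ∘ legBeads-HookLeg k .sound))
    movable-4 {suc (suc (suc (suc (suc c))))} b∈ =
      cong not (∈⇒member≡true {xs = 5 + n ∷ legBeads k} (there (∈-legBeads⁺ z<s 1+c≤k)))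
      where
      1+c≤k : suc c ≤ k
      1+c≤k = ≤-trans (m≤n+m (suc c) 4) (InHookLeg⇒≤ (legBeads-HookLeg k .sound b∈))

  between-arm-legBeads : ∀ n k → suc n ∉ legBeads k → between (suc n) (5 + n) (5 + n ∷ legBeads k) ≡ 0
  between-arm-legBeads n k 1+n∉ = between-empty (suc n) (5 + n) (5 + n ∷ legBeads k) no-bead
    where
    k≤n : k ≤ n
    k≤n = ≮⇒≥ (λ n<k → 1+n∉ (∈-legBeads⁺ z<s n<k))
    no-bead : ∀ {c} → c ∈ 5 + n ∷ legBeads k → ¬ (suc n < c × c < 5 + n)
    no-bead (here refl) (_ , c<c) = n≮n _ c<c
    no-bead (there c∈)  (n<c , _) =
      <⇒≱ n<c (≤-trans (InHookLeg⇒≤ (legBeads-HookLeg k .sound c∈)) (m≤n⇒m≤1+n k≤n))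

  strips-4-hook : ∀ n k → strips 4 (5 + n ∷ legBeads k) (5 + n ∷ legBeads k) ≡
    (if member (suc n) (legBeads k) then [] else [ (+ 1 , suc n ∷ legBeads k) ]) ++
    (if member 4 (legBeads k)
       then [ (sgn (between 0 4 (legBeads k)) , 5 + n ∷ replaceBead 4 0 (legBeads k)) ] else [])
  strips-4-hook n k rewrite strips-head 3 (suc n) (legBeads k) | strips-4-legBeads n k
    with suc n ∈? legBeads k
  ... | yes 1+n∈ rewrite ∈⇒member≡true 1+n∈ = refl
  ... | no 1+n∉  rewrite ∉⇒member≡false 1+n∉ | between-arm-legBeads n k 1+n∉ = refl

  between-0-4-legBeads : ∀ L → between 0 4 (legBeads (4 + L)) ≡ 3
  between-0-4-legBeads zero    = refl
  between-0-4-legBeads (suc L) = between-0-4-legBeads L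

  i+[4+L]≡4+[i+L] : ∀ i L → i + (4 + L) ≡ 4 + (i + L)
  i+[4+L]≡4+[i+L] = ℕ-Solver.solve-∀

  -- n C (i − 4), vanishing for i < 4 (truncated subtraction would give n C 0 = 1).
  choose4 : ℕ → ℕ → ℕ
  choose4 n (suc (suc (suc (suc a)))) = n C a
  choose4 n _                         = 0

  choose4-<4 : ∀ n {i} → i < 4 → choose4 n i ≡ 0
  choose4-<4 n {0} _ = refl
  choose4-<4 n {1} _ = refl
  choose4-<4 n {2} _ = refl
  choose4-<4 n {3} _ = refl
  choose4-<4 n {suc (suc (suc (suc _)))} (s≤s (s≤s (s≤s (s≤s ()))))

  -- 5 + n ∷ legBeads k is the beta-set of a hook (i + 1, 1^k) with i + k = 4 + n. Its arm
  -- loses four cells when the top bead moves to n + 1, its leg when bead 4 moves to 0.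
  module _ (n k : ℕ) where

    private
      μ Q₄ : List ℕ
      μ  = replicate (suc n) 1
      Q₄ = replaceBead 4 0 (legBeads k)

    mnβ-4-arm-and-leg : ∀ a L → n ≡ a + k → k ≡ 4 + L →
      mnβ (5 + n ∷ legBeads k) (4 ∷ μ) ≡ + (n C a) ℤ.- + (n C (4 + a))
    mnβ-4-arm-and-leg a L refl refl = begin
      mnβ (5 + n ∷ legBeads k) (4 ∷ μ)
        ≡⟨ mnβ-pair (5 + n ∷ legBeads k) 4 μ strips-eq ⟩
      + 1 ℤ.* mnβ (suc n ∷ legBeads k) μ ℤ.+ -1ℤ ℤ.* mnβ (5 + n ∷ Q₄) μ
        ≡⟨ cong₂ ℤ._+_ (ℤ.*-identityˡ (mnβ (suc n ∷ legBeads k) μ))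
                       (ℤ.-1*i≡-i (mnβ (5 + n ∷ Q₄) μ)) ⟩
      mnβ (suc n ∷ legBeads k) μ ℤ.- mnβ (5 + n ∷ Q₄) μ
        ≡⟨ cong₂ ℤ._-_ (mnβ-hook-dimension k a (legBeads-HookLeg k) (+-comm a k) refl)
                       (mnβ-hook-dimension L (4 + a) (HookLeg-slide 3 (legBeads-HookLeg k))
                                           (a+[4+L]≡L+[4+a] a L) refl) ⟩
      + (n C a) ℤ.- + (n C (4 + a))
        ∎
      where
      open ≡-Reasoning
      a+[4+L]≡L+[4+a] : ∀ a L → a + (4 + L) ≡ L + (4 + a)
      a+[4+L]≡L+[4+a] = ℕ-Solver.solve-∀
      strips-eq : strips 4 (5 + n ∷ legBeads k) (5 + n ∷ legBeads k) ≡
        (+ 1 , suc n ∷ legBeads k) ∷ (-1ℤ , 5 + n ∷ Q₄) ∷ []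
      strips-eq rewrite strips-4-hook n k | ∉⇒member≡false (∉-legBeads {k = k} (s≤s (m≤n+m k a)))
                      | ∈⇒member≡true (∈-legBeads⁺ {k = k} z<s (m≤m+n 4 L)) | between-0-4-legBeads L = refl

    mnβ-4-arm : ∀ a → n ≡ a + k → k < 4 →
      mnβ (5 + n ∷ legBeads k) (4 ∷ μ) ≡ + (n C a) ℤ.- + (n C (4 + a))
    mnβ-4-arm a refl k<4 = begin
      mnβ (5 + n ∷ legBeads k) (4 ∷ μ)       ≡⟨ mnβ-single (5 + n ∷ legBeads k) 4 μ strips-eq ⟩
      + 1 ℤ.* mnβ (suc n ∷ legBeads k) μ     ≡⟨ ℤ.*-identityˡ (mnβ (suc n ∷ legBeads k) μ) ⟩
      mnβ (suc n ∷ legBeads k) μ             ≡⟨ mnβ-hook-dimension k a (legBeads-HookLeg k) (+-comm a k) refl ⟩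
      + (n C a)                              ≡⟨ ℤ.+-identityʳ (+ (n C a)) ⟨
      + (n C a) ℤ.- + 0                      ≡⟨ cong (λ x → + (n C a) ℤ.- + x) (k>n⇒nCk≡0 n<4+a) ⟨
      + (n C a) ℤ.- + (n C (4 + a))          ∎
      where
      open ≡-Reasoning
      n<4+a : n < 4 + a
      n<4+a = ≤-trans (≤-reflexive (cong suc (+-comm a k))) (+-monoˡ-≤ a k<4)
      strips-eq : strips 4 (5 + n ∷ legBeads k) (5 + n ∷ legBeads k) ≡ [ (+ 1 , suc n ∷ legBeads k) ]
      strips-eq rewrite strips-4-hook n k | ∉⇒member≡false (∉-legBeads {k = k} (s≤s (m≤n+m k a)))
                      | ∉⇒member≡false (∉-legBeads {k = k} k<4) = refl

    mnβ-4-leg : ∀ i L → n ≡ i + L → k ≡ 4 + L → i < 4 →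
      mnβ (5 + n ∷ legBeads k) (4 ∷ μ) ≡ + choose4 n i ℤ.- + (n C i)
    mnβ-4-leg i L refl refl i<4 = begin
      mnβ (5 + n ∷ legBeads k) (4 ∷ μ)       ≡⟨ mnβ-single (5 + n ∷ legBeads k) 4 μ strips-eq ⟩
      -1ℤ ℤ.* mnβ (5 + n ∷ Q₄) μ             ≡⟨ ℤ.-1*i≡-i (mnβ (5 + n ∷ Q₄) μ) ⟩
      ℤ.- mnβ (5 + n ∷ Q₄) μ                 ≡⟨ cong ℤ.-_ (mnβ-hook-dimension L i
                                                    (HookLeg-slide 3 (legBeads-HookLeg k)) (+-comm i L) refl) ⟩
      ℤ.- + (n C i)                          ≡⟨ ℤ.+-identityˡ (ℤ.- + (n C i)) ⟨
      + 0 ℤ.- + (n C i)                      ≡⟨ cong (λ x → + x ℤ.- + (n C i)) (choose4-<4 n i<4) ⟨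
      + choose4 n i ℤ.- + (n C i)            ∎
      where
      open ≡-Reasoning
      strips-eq : strips 4 (5 + n ∷ legBeads k) (5 + n ∷ legBeads k) ≡ [ (-1ℤ , 5 + n ∷ Q₄) ]
      strips-eq rewrite strips-4-hook n k
                      | ∈⇒member≡true (∈-legBeads⁺ {k = k} z<s (s≤s (+-monoˡ-≤ L (≤-pred i<4))))
                      | ∈⇒member≡true (∈-legBeads⁺ {k = k} z<s (m≤m+n 4 L)) | between-0-4-legBeads L = refl

    mnβ-4-none : ∀ i → i + k ≡ 4 + n → i < 4 → k < 4 →
      mnβ (5 + n ∷ legBeads k) (4 ∷ μ) ≡ + choose4 n i ℤ.- + (n C i)
    mnβ-4-none i i+k≡4+n i<4 k<4 = begin
      mnβ (5 + n ∷ legBeads k) (4 ∷ μ)       ≡⟨ mnβ-none (5 + n ∷ legBeads k) 4 μ strips-eq ⟩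
      + 0                                    ≡⟨ cong₂ (λ x y → + x ℤ.- + y) (choose4-<4 n i<4) (k>n⇒nCk≡0 n<i) ⟨
      + choose4 n i ℤ.- + (n C i)            ∎
      where
      open ≡-Reasoning
      n<i : n < i
      n<i = +-cancelˡ-≤ 3 (suc n) i
              (≤-trans (≤-reflexive (sym i+k≡4+n))
                       (≤-trans (+-monoʳ-≤ i (≤-pred k<4)) (≤-reflexive (+-comm i 3))))
      n<k : n < k
      n<k = +-cancelˡ-≤ 3 (suc n) k (≤-trans (≤-reflexive (sym i+k≡4+n)) (+-monoˡ-≤ k (≤-pred i<4)))
      strips-eq : strips 4 (5 + n ∷ legBeads k) (5 + n ∷ legBeads k) ≡ []
      strips-eq rewrite strips-4-hook n k | ∈⇒member≡true (∈-legBeads⁺ {k = k} z<s n<k)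
                      | ∉⇒member≡false (∉-legBeads {k = k} k<4) = refl

  mnβ-hook-fourCycle : ∀ n i k → i + k ≡ 4 + n →
    mnβ (5 + n ∷ legBeads k) (4 ∷ replicate (suc n) 1) ≡ + choose4 n i ℤ.- + (n C i)
  mnβ-hook-fourCycle n i k i+k≡4+n with 4 ≤? i | 4 ≤? k
  ... | yes 4≤i | yes 4≤k with a , refl ← m≤n⇒∃[o]m+o≡n 4≤i | L , refl ← m≤n⇒∃[o]m+o≡n 4≤k =
    mnβ-4-arm-and-leg n k a L (sym (+-cancelˡ-≡ 4 _ _ i+k≡4+n)) refl
  ... | yes 4≤i | no 4≰k with a , refl ← m≤n⇒∃[o]m+o≡n 4≤i =
    mnβ-4-arm n k a (sym (+-cancelˡ-≡ 4 _ _ i+k≡4+n)) (≰⇒> 4≰k)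
  ... | no 4≰i | yes 4≤k with L , refl ← m≤n⇒∃[o]m+o≡n 4≤k =
    mnβ-4-leg n k i L (sym (+-cancelˡ-≡ 4 _ _ (trans (sym (i+[4+L]≡4+[i+L] i L)) i+k≡4+n)))
              refl (≰⇒> 4≰i)
  ... | no 4≰i | no 4≰k = mnβ-4-none n k i i+k≡4+n (≰⇒> 4≰i) (≰⇒> 4≰k)

  size-replicate-1 : ∀ k → size (replicate k 1) ≡ k
  size-replicate-1 zero    = refl
  size-replicate-1 (suc k) = cong suc (size-replicate-1 k)

  beta-hook : ∀ j k → beta (j ∷ replicate k 1) ≡ j + k ∷ legBeads k
  beta-hook j k rewrite length-replicate k {1} = cong (j + k ∷_) (betaAux-replicate k)
    where
    betaAux-replicate : ∀ k → betaAux (k ∸ 1) (replicate k 1) ≡ legBeads k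
    betaAux-replicate zero    = refl
    betaAux-replicate (suc k) = cong (suc k ∷_) (betaAux-replicate k)

  χ-hook : ∀ j k {n} μ → j + k ≡ n → size μ ≡ n → χ (j ∷ replicate k 1) μ ≡ mnβ (n ∷ legBeads k) μ
  χ-hook j k μ refl size-μ
    rewrite size-replicate-1 k | size-μ | ≡ᵇ-refl (j + k) | beta-hook j k = refl

  χ-hook-fourCycle : ∀ p i → i < 5 + p →
    χ (hook (5 + p) (suc i)) (fourCycle (5 + p)) ≡ + choose4 p i ℤ.- + (p C i)
  χ-hook-fourCycle p i i<5+p =
    trans (χ-hook (suc i) k (fourCycle (5 + p)) (cong suc i+k≡4+p)
                  (cong (λ x → 4 + x) (size-replicate-1 (suc p))))
          (mnβ-hook-fourCycle p i k i+k≡4+p)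
    where
    k : ℕ
    k = 4 + p ∸ i
    i+k≡4+p : i + k ≡ 4 + p
    i+k≡4+p = m+[n∸m]≡n (≤-pred i<5+p)

  -- The sum of squares

  -- Any range N > a: the induction step then needs no splitting off of a last term.
  vandermonde : ∀ a b d N → a < N → ∑[ i < N ] ((a C toℕ i) * (b C (d + toℕ i))) ≡ (a + b) C (d + a)
  vandermonde zero b d (suc N) _ = begin
    1 * (b C (d + 0)) + ∑[ i < N ] 0   ≡⟨ cong (λ s → 1 * (b C (d + 0)) + s) (sum-replicate-zero N) ⟩
    1 * (b C (d + 0)) + 0              ≡⟨ +-identityʳ _ ⟩
    1 * (b C (d + 0))                  ≡⟨ *-identityˡ _ ⟩
    b C (d + 0)                        ∎
    where open ≡-Reasoning
  vandermonde (suc a) b d (suc N) (s≤s a<N) = begin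
    h + ∑[ i < N ] ((suc a C suc (toℕ i)) * (b C (d + suc (toℕ i))))
      ≡⟨ cong (_+_ h) (trans (sum-cong-≗ {N} pascal) (∑-distrib-+ {N} f g)) ⟩
    h + (∑[ i < N ] f i + ∑[ i < N ] g i)
      ≡⟨ x∙yz≈y∙xz h (∑[ i < N ] f i) (∑[ i < N ] g i) ⟩
    ∑[ i < N ] f i + (h + ∑[ i < N ] g i)
      ≡⟨ cong₂ _+_ (vandermonde a b (suc d) N a<N) (vandermonde a b d (suc N) (m<n⇒m<1+n a<N)) ⟩
    (a + b) C suc (d + a) + (a + b) C (d + a)
      ≡⟨ +-comm ((a + b) C suc (d + a)) _ ⟩
    (a + b) C (d + a) + (a + b) C suc (d + a)
      ≡⟨ nCk+nC[k+1]≡[n+1]C[k+1] (a + b) (d + a) ⟩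
    suc (a + b) C suc (d + a)
      ≡⟨ cong (suc (a + b) C_) (+-suc d a) ⟨
    (suc a + b) C (d + suc a)
      ∎
    where
    open ≡-Reasoning
    h : ℕ
    h = 1 * (b C (d + 0))
    f g : Fin N → ℕ
    f i = (a C toℕ i) * (b C (suc d + toℕ i))
    g i = (a C suc (toℕ i)) * (b C (d + suc (toℕ i)))
    pascal : ∀ i → (suc a C suc (toℕ i)) * (b C (d + suc (toℕ i))) ≡ f i + g i
    pascal i = begin
      (suc a C suc (toℕ i)) * B                  ≡⟨ cong (_* B) (nCk+nC[k+1]≡[n+1]C[k+1] a (toℕ i)) ⟨
      ((a C toℕ i) + (a C suc (toℕ i))) * B      ≡⟨ *-distribʳ-+ B (a C toℕ i) (a C suc (toℕ i)) ⟩
      (a C toℕ i) * B + g i                      ≡⟨ cong (λ x → (a C toℕ i) * (b C x) + g i) (+-suc d (toℕ i)) ⟩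
      f i + g i                                  ∎
      where
      B : ℕ
      B = b C (d + suc (toℕ i))

  foldr-map-applyUpTo : ∀ (f : ℕ → ℤ) g n →
    foldr ℤ._+_ (+ 0) (map f (applyUpTo g n)) ≡ ℤΣ.sum {n} (λ i → f (g (toℕ i)))
  foldr-map-applyUpTo f g zero    = refl
  foldr-map-applyUpTo f g (suc n) = cong (ℤ._+_ (f (g 0))) (foldr-map-applyUpTo f (g ∘ suc) n)

  ∑-pos : ∀ {n} (f : Fin n → ℕ) → ℤΣ.sum {n} (λ i → + f i) ≡ + ∑[ i < n ] f i
  ∑-pos {zero}  f = refl
  ∑-pos {suc n} f = trans (cong (ℤ._+_ (+ f Fin.zero)) (∑-pos (f ∘ Fin.suc))) (sym (ℤ.pos-+ (f Fin.zero) _))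

  ∑-pos-* : ∀ {n} (f g : Fin n → ℕ) → ℤΣ.sum {n} (λ i → + f i ℤ.* + g i) ≡ + ∑[ i < n ] (f i * g i)
  ∑-pos-* f g = trans (ℤΣ.sum-cong-≗ (λ i → sym (ℤ.pos-* (f i) (g i)))) (∑-pos (λ i → f i * g i))

  ∑-square-difference : ∀ {n} (a b : Fin n → ℕ) →
    ℤΣ.sum {n} (λ i → (+ a i ℤ.- + b i) ℤ.* (+ a i ℤ.- + b i)) ≡
    + ∑[ i < n ] (a i * a i) ℤ.+ + ∑[ i < n ] (b i * b i) ℤ.+ ℤ.- + 2 ℤ.* + ∑[ i < n ] (a i * b i)
  ∑-square-difference {n} a b = begin
    ℤΣ.sum (λ i → (A i ℤ.- B i) ℤ.* (A i ℤ.- B i))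
      ≡⟨ ℤΣ.sum-cong-≗ {n} (λ i → square-difference (A i) (B i)) ⟩
    ℤΣ.sum (λ i → A i ℤ.* A i ℤ.+ B i ℤ.* B i ℤ.+ ℤ.- + 2 ℤ.* (A i ℤ.* B i))
      ≡⟨ ℤΣ.∑-distrib-+ {n} (λ i → A i ℤ.* A i ℤ.+ B i ℤ.* B i) (λ i → ℤ.- + 2 ℤ.* (A i ℤ.* B i)) ⟩
    ℤΣ.sum (λ i → A i ℤ.* A i ℤ.+ B i ℤ.* B i) ℤ.+ ℤΣ.sum (λ i → ℤ.- + 2 ℤ.* (A i ℤ.* B i))
      ≡⟨ cong₂ ℤ._+_ (ℤΣ.∑-distrib-+ {n} (λ i → A i ℤ.* A i) (λ i → B i ℤ.* B i))
                     (sym (ℤΣ.*-distribˡ-sum {n} (ℤ.- + 2) (λ i → A i ℤ.* B i))) ⟩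
    ℤΣ.sum (λ i → A i ℤ.* A i) ℤ.+ ℤΣ.sum (λ i → B i ℤ.* B i) ℤ.+ ℤ.- + 2 ℤ.* ℤΣ.sum (λ i → A i ℤ.* B i)
      ≡⟨ cong₂ ℤ._+_ (cong₂ ℤ._+_ (∑-pos-* a a) (∑-pos-* b b)) (cong (ℤ._*_ (ℤ.- + 2)) (∑-pos-* a b)) ⟩
    + ∑[ i < n ] (a i * a i) ℤ.+ + ∑[ i < n ] (b i * b i) ℤ.+ ℤ.- + 2 ℤ.* + ∑[ i < n ] (a i * b i)
      ∎
    where
    open ≡-Reasoning
    A B : Fin n → ℤ
    A i = + a i
    B i = + b i
    square-difference : ∀ x y → (x ℤ.- y) ℤ.* (x ℤ.- y) ≡ x ℤ.* x ℤ.+ y ℤ.* y ℤ.+ ℤ.- + 2 ℤ.* (x ℤ.* y)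
    square-difference = ℤ-Solver.solve-∀

  hookSquareSum-closedForm : ∀ p →
    hookSquareSum (5 + p) ≡ + 2 ℤ.* (+ ((p + p) C p) ℤ.- + ((p + p) C (4 + p)))
  hookSquareSum-closedForm p = begin
    hookSquareSum (5 + p)
      ≡⟨ foldr-map-applyUpTo (λ i → c i ℤ.* c i) (λ i → i) (5 + p) ⟩
    ℤΣ.sum {5 + p} (λ i → c (toℕ i) ℤ.* c (toℕ i))
      ≡⟨ ℤΣ.sum-cong-≗ {5 + p} (λ i → cong (λ x → x ℤ.* x) (χ-hook-fourCycle p (toℕ i) (toℕ<n i))) ⟩
    ℤΣ.sum {5 + p} (λ i → (+ a i ℤ.- + b i) ℤ.* (+ a i ℤ.- + b i))
      ≡⟨ ∑-square-difference a b ⟩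
    + ∑[ i < 5 + p ] (a i * a i) ℤ.+ + ∑[ i < 5 + p ] (b i * b i)
      ℤ.+ ℤ.- + 2 ℤ.* + ∑[ i < 5 + p ] (a i * b i)
      ≡⟨ cong₂ (λ x y → + x ℤ.+ + y ℤ.+ ℤ.- + 2 ℤ.* + ∑[ i < 5 + p ] (a i * b i))
               (vandermonde p p 0 (suc p) ≤-refl) (vandermonde p p 0 (5 + p) (m≤n+m (suc p) 4)) ⟩
    + N ℤ.+ + N ℤ.+ ℤ.- + 2 ℤ.* + ∑[ i < 5 + p ] (a i * b i)
      ≡⟨ cong (λ x → + N ℤ.+ + N ℤ.+ ℤ.- + 2 ℤ.* + x) (vandermonde p p 4 (suc p) ≤-refl) ⟩
    + N ℤ.+ + N ℤ.+ ℤ.- + 2 ℤ.* + X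
      ≡⟨ x+x-2y≡2[x-y] (+ N) (+ X) ⟩
    + 2 ℤ.* (+ N ℤ.- + X)
      ∎
    where
    open ≡-Reasoning
    N X : ℕ
    N = (p + p) C p
    X = (p + p) C (4 + p)
    c : ℕ → ℤ
    c i = χ (hook (5 + p) (suc i)) (fourCycle (5 + p))
    a b : Fin (5 + p) → ℕ
    a i = choose4 p (toℕ i)
    b i = p C toℕ i
    x+x-2y≡2[x-y] : ∀ x y → x ℤ.+ x ℤ.+ ℤ.- + 2 ℤ.* y ≡ + 2 ℤ.* (x ℤ.- y)
    x+x-2y≡2[x-y] = ℤ-Solver.solve-∀

  -- Binomial ratios

  nC[1+k]*[1+k]+k*nCk≡n*nCk : ∀ n k → (n C suc k) * suc k + k * (n C k) ≡ n * (n C k)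
  nC[1+k]*[1+k]+k*nCk≡n*nCk zero    zero    = refl
  nC[1+k]*[1+k]+k*nCk≡n*nCk zero    (suc k) = *-zeroʳ (suc k)
  nC[1+k]*[1+k]+k*nCk≡n*nCk (suc m) zero    = begin
    (suc m C 1) * 1 + 0   ≡⟨ +-identityʳ _ ⟩
    (suc m C 1) * 1       ≡⟨ *-identityʳ _ ⟩
    suc m C 1             ≡⟨ nC1≡n (suc m) ⟩
    suc m                 ≡⟨ *-identityʳ (suc m) ⟨
    suc m * 1             ∎
    where open ≡-Reasoning
  nC[1+k]*[1+k]+k*nCk≡n*nCk (suc m) (suc k) = begin
    (suc m C (2 + k)) * (2 + k) + suc k * (suc m C suc k)
      ≡⟨ cong₂ (λ u v → u * (2 + k) + suc k * v)
               (nCk+nC[k+1]≡[n+1]C[k+1] m (suc k)) (nCk+nC[k+1]≡[n+1]C[k+1] m k) ⟨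
    (b + c) * (2 + k) + suc k * (a + b)
      ≡⟨ regroup a b c k ⟩
    (c * (2 + k) + suc k * b) + ((b * suc k + k * a) + (a + b))
      ≡⟨ cong₂ (λ u v → u + (v + (a + b)))
               (nC[1+k]*[1+k]+k*nCk≡n*nCk m (suc k)) (nC[1+k]*[1+k]+k*nCk≡n*nCk m k) ⟩
    m * b + (m * a + (a + b))
      ≡⟨ collect m a b ⟩
    suc m * (a + b)
      ≡⟨ cong (suc m *_) (nCk+nC[k+1]≡[n+1]C[k+1] m k) ⟩
    suc m * (suc m C suc k)
      ∎
    where
    open ≡-Reasoning
    a b c : ℕ
    a = m C k
    b = m C suc k
    c = m C (2 + k)
    regroup : ∀ a b c k → (b + c) * (2 + k) + suc k * (a + b) ≡
                          (c * (2 + k) + suc k * b) + ((b * suc k + k * a) + (a + b))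
    regroup = ℕ-Solver.solve-∀
    collect : ∀ m a b → m * b + (m * a + (a + b)) ≡ suc m * (a + b)
    collect = ℕ-Solver.solve-∀

  central-binomial-step : ∀ q → ((suc q + suc q) C suc q) * suc q ≡ 2 * suc (q + q) * ((q + q) C q)
  central-binomial-step q = begin
    ((suc q + suc q) C suc q) * suc q
      ≡⟨ cong (λ x → (suc x C suc q) * suc q) (+-suc q q) ⟩
    ((2 + (q + q)) C suc q) * suc q
      ≡⟨ cong (_* suc q) (nCk+nC[k+1]≡[n+1]C[k+1] (suc (q + q)) q) ⟨
    ((suc (q + q) C q) + M) * suc q
      ≡⟨ cong (λ x → (x + M) * suc q) symmetric ⟩
    (M + M) * suc q
      ≡⟨ cong (λ x → (x + x) * suc q) (nCk+nC[k+1]≡[n+1]C[k+1] (q + q) q) ⟨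
    ((N + N₁) + (N + N₁)) * suc q
      ≡⟨ expand N N₁ q ⟩
    2 * (N * suc q + N₁ * suc q)
      ≡⟨ cong (λ x → 2 * (N * suc q + x)) N₁*[1+q]≡q*N ⟩
    2 * (N * suc q + q * N)
      ≡⟨ collect N q ⟩
    2 * suc (q + q) * N
      ∎
    where
    open ≡-Reasoning
    N N₁ M : ℕ
    N  = (q + q) C q
    N₁ = (q + q) C suc q
    M  = suc (q + q) C suc q
    symmetric : suc (q + q) C q ≡ M
    symmetric = trans (nCk≡nC[n∸k] (m≤n⇒m≤1+n (m≤m+n q q)))
                      (cong (suc (q + q) C_) (trans (cong (_∸ q) (sym (+-suc q q))) (m+n∸m≡n q (suc q))))
    N₁*[1+q]≡q*N : N₁ * suc q ≡ q * N
    N₁*[1+q]≡q*N = +-cancelʳ-≡ (q * N) (N₁ * suc q) (q * N)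
                     (trans (nC[1+k]*[1+k]+k*nCk≡n*nCk (q + q) q) (*-distribʳ-+ N q q))
    expand : ∀ N N₁ q → ((N + N₁) + (N + N₁)) * suc q ≡ 2 * (N * suc q + N₁ * suc q)
    expand = ℕ-Solver.solve-∀
    collect : ∀ N q → 2 * (N * suc q + q * N) ≡ 2 * suc (q + q) * N
    collect = ℕ-Solver.solve-∀

  ∏ : ℕ → (ℕ → ℤ) → ℤ
  ∏ zero    g = + 1
  ∏ (suc m) g = ∏ m g ℤ.* g m

  telescope : ∀ (f g h : ℕ → ℤ) → (∀ t → f (suc t) ℤ.* g t ≡ h t ℤ.* f t) →
    ∀ m → f m ℤ.* ∏ m g ≡ f 0 ℤ.* ∏ m h
  telescope f g h step zero    = refl
  telescope f g h step (suc m) = begin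
    f (suc m) ℤ.* (∏ m g ℤ.* g m)    ≡⟨ ℤ*.x∙yz≈xz∙y (f (suc m)) (∏ m g) (g m) ⟩
    f (suc m) ℤ.* g m ℤ.* ∏ m g      ≡⟨ cong (ℤ._* ∏ m g) (step m) ⟩
    h m ℤ.* f m ℤ.* ∏ m g            ≡⟨ ℤ.*-assoc (h m) (f m) (∏ m g) ⟩
    h m ℤ.* (f m ℤ.* ∏ m g)          ≡⟨ cong (h m ℤ.*_) (telescope f g h step m) ⟩
    h m ℤ.* (f 0 ℤ.* ∏ m h)          ≡⟨ ℤ*.x∙yz≈y∙zx (h m) (f 0) (∏ m h) ⟩
    f 0 ℤ.* (∏ m h ℤ.* h m)          ∎
    where open ≡-Reasoning

  cast-absorption : ∀ n k → + (n C suc k) ℤ.* + suc k ℤ.+ + k ℤ.* + (n C k) ≡ + n ℤ.* + (n C k)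
  cast-absorption n k = begin
    + (n C suc k) ℤ.* + suc k ℤ.+ + k ℤ.* + (n C k)
      ≡⟨ cong₂ ℤ._+_ (ℤ.pos-* (n C suc k) (suc k)) (ℤ.pos-* k (n C k)) ⟨
    + ((n C suc k) * suc k) ℤ.+ + (k * (n C k))
      ≡⟨ ℤ.pos-+ ((n C suc k) * suc k) (k * (n C k)) ⟨
    + ((n C suc k) * suc k + k * (n C k))
      ≡⟨ cong +_ (nC[1+k]*[1+k]+k*nCk≡n*nCk n k) ⟩
    + (n * (n C k))
      ≡⟨ ℤ.pos-* n (n C k) ⟩
    + n ℤ.* + (n C k)
      ∎
    where open ≡-Reasoning

  central : ℕ → ℕ
  central q = (q + q) C q

  module _ (p : ℕ) where

    private
      P : ℤ
      P = + p

    binomial-ratio : ∀ t →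
      + ((p + p) C (suc t + p)) ℤ.* (+ suc t ℤ.+ P) ≡ (P ℤ.- + t) ℤ.* + ((p + p) C (t + p))
    binomial-ratio t = begin
      U ℤ.* (+ suc t ℤ.+ P)
        ≡⟨ cong (U ℤ.*_) (ℤ.pos-+ (suc t) p) ⟨
      U ℤ.* + suc (t + p)
        ≡⟨ a≡a+b-b (U ℤ.* + suc (t + p)) (+ (t + p) ℤ.* V) ⟩
      U ℤ.* + suc (t + p) ℤ.+ + (t + p) ℤ.* V ℤ.- + (t + p) ℤ.* V
        ≡⟨ cong (ℤ._- + (t + p) ℤ.* V) (cast-absorption (p + p) (t + p)) ⟩
      + (p + p) ℤ.* V ℤ.- + (t + p) ℤ.* V
        ≡⟨ cong₂ (λ a b → a ℤ.* V ℤ.- b ℤ.* V) (ℤ.pos-+ p p) (ℤ.pos-+ t p) ⟩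
      (P ℤ.+ P) ℤ.* V ℤ.- (+ t ℤ.+ P) ℤ.* V
        ≡⟨ factor P (+ t) V ⟩
      (P ℤ.- + t) ℤ.* V
        ∎
      where
      open ≡-Reasoning
      U V : ℤ
      U = + ((p + p) C (suc t + p))
      V = + ((p + p) C (t + p))
      a≡a+b-b : ∀ a b → a ≡ a ℤ.+ b ℤ.- b
      a≡a+b-b = ℤ-Solver.solve-∀
      factor : ∀ P T V → (P ℤ.+ P) ℤ.* V ℤ.- (T ℤ.+ P) ℤ.* V ≡ (P ℤ.- T) ℤ.* V
      factor = ℤ-Solver.solve-∀

    central-ratio : ∀ t → + central (suc t + p) ℤ.* (+ suc t ℤ.+ P) ≡
      + 2 ℤ.* (+ 1 ℤ.+ ((+ t ℤ.+ P) ℤ.+ (+ t ℤ.+ P))) ℤ.* + central (t + p)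
    central-ratio t = begin
      + central (suc q) ℤ.* (+ suc t ℤ.+ P)
        ≡⟨ cong (+ central (suc q) ℤ.*_) (ℤ.pos-+ (suc t) p) ⟨
      + central (suc q) ℤ.* + suc q
        ≡⟨ ℤ.pos-* (central (suc q)) (suc q) ⟨
      + (central (suc q) * suc q)
        ≡⟨ cong +_ (central-binomial-step q) ⟩
      + (2 * suc (q + q) * central q)
        ≡⟨ ℤ.pos-* (2 * suc (q + q)) (central q) ⟩
      + (2 * suc (q + q)) ℤ.* + central q
        ≡⟨ cong (ℤ._* + central q) (ℤ.pos-* 2 (suc (q + q))) ⟩
      + 2 ℤ.* + suc (q + q) ℤ.* + central q
        ≡⟨ cong (λ x → + 2 ℤ.* x ℤ.* + central q) cast ⟩
      + 2 ℤ.* (+ 1 ℤ.+ ((+ t ℤ.+ P) ℤ.+ (+ t ℤ.+ P))) ℤ.* + central q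
        ∎
      where
      open ≡-Reasoning
      q : ℕ
      q = t + p
      cast : + suc (q + q) ≡ + 1 ℤ.+ ((+ t ℤ.+ P) ℤ.+ (+ t ℤ.+ P))
      cast = trans (ℤ.pos-+ 1 (q + q))
                   (cong (ℤ._+_ (+ 1)) (trans (ℤ.pos-+ q q) (cong₂ ℤ._+_ (ℤ.pos-+ t p) (ℤ.pos-+ t p))))

    private
      N X F T Q : ℤ
      N = + ((p + p) C p)
      X = + ((p + p) C (4 + p))
      F = + central (4 + p)
      T = (+ 7 ℤ.+ (P ℤ.+ P)) ℤ.* (+ 5 ℤ.+ (P ℤ.+ P)) ℤ.* (+ 3 ℤ.+ (P ℤ.+ P))
      Q = (+ 5 ℤ.+ P) ℤ.* (+ 5 ℤ.+ P) ℤ.- + 9 ℤ.* (+ 5 ℤ.+ P) ℤ.+ + 23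
      g hX hF : ℕ → ℤ
      g t  = + suc t ℤ.+ P
      hX t = P ℤ.- + t
      hF t = + 2 ℤ.* (+ 1 ℤ.+ ((+ t ℤ.+ P) ℤ.+ (+ t ℤ.+ P)))

    -- Multiplying by ∏ 4 g = (p + 1)(p + 2)(p + 3)(p + 4) turns X and F into N times polynomials.
    hookSquareSum-identity : + 2 ℤ.* (N ℤ.- X) ℤ.* T ≡ Q ℤ.* F
    hookSquareSum-identity = ℤ.*-cancelʳ-≡ _ _ (∏ 4 g) (begin
      + 2 ℤ.* (N ℤ.- X) ℤ.* T ℤ.* ∏ 4 g
        ≡⟨ expand N X T (∏ 4 g) ⟩
      + 2 ℤ.* T ℤ.* (N ℤ.* ∏ 4 g) ℤ.- + 2 ℤ.* T ℤ.* (X ℤ.* ∏ 4 g)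
        ≡⟨ cong (λ x → + 2 ℤ.* T ℤ.* (N ℤ.* ∏ 4 g) ℤ.- + 2 ℤ.* T ℤ.* x)
                (telescope (λ t → + ((p + p) C (t + p))) g hX binomial-ratio 4) ⟩
      + 2 ℤ.* T ℤ.* (N ℤ.* ∏ 4 g) ℤ.- + 2 ℤ.* T ℤ.* (N ℤ.* ∏ 4 hX)
        ≡⟨ key N P ⟩
      Q ℤ.* (N ℤ.* ∏ 4 hF)
        ≡⟨ cong (Q ℤ.*_) (telescope (λ t → + central (t + p)) g hF central-ratio 4) ⟨
      Q ℤ.* (F ℤ.* ∏ 4 g)
        ≡⟨ ℤ.*-assoc Q F (∏ 4 g) ⟨
      Q ℤ.* F ℤ.* ∏ 4 g
        ∎)
      where
      open ≡-Reasoning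
      expand : ∀ N X T D →
        + 2 ℤ.* (N ℤ.- X) ℤ.* T ℤ.* D ≡ + 2 ℤ.* T ℤ.* (N ℤ.* D) ℤ.- + 2 ℤ.* T ℤ.* (X ℤ.* D)
      expand = ℤ-Solver.solve-∀
      -- ∏ 4 g, ∏ 4 hX and ∏ 4 hF are written out because the ring solver does not unfold ∏.
      key : ∀ N P →
        let T = (+ 7 ℤ.+ (P ℤ.+ P)) ℤ.* (+ 5 ℤ.+ (P ℤ.+ P)) ℤ.* (+ 3 ℤ.+ (P ℤ.+ P)) in
        + 2 ℤ.* T ℤ.* (N ℤ.* (+ 1 ℤ.* (+ 1 ℤ.+ P) ℤ.* (+ 2 ℤ.+ P) ℤ.* (+ 3 ℤ.+ P) ℤ.* (+ 4 ℤ.+ P)))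
          ℤ.- + 2 ℤ.* T ℤ.* (N ℤ.* (+ 1 ℤ.* (P ℤ.- + 0) ℤ.* (P ℤ.- + 1) ℤ.* (P ℤ.- + 2) ℤ.* (P ℤ.- + 3)))
        ≡ ((+ 5 ℤ.+ P) ℤ.* (+ 5 ℤ.+ P) ℤ.- + 9 ℤ.* (+ 5 ℤ.+ P) ℤ.+ + 23)
          ℤ.* (N ℤ.* (+ 1 ℤ.* (+ 2 ℤ.* (+ 1 ℤ.+ ((+ 0 ℤ.+ P) ℤ.+ (+ 0 ℤ.+ P))))
                            ℤ.* (+ 2 ℤ.* (+ 1 ℤ.+ ((+ 1 ℤ.+ P) ℤ.+ (+ 1 ℤ.+ P))))
                            ℤ.* (+ 2 ℤ.* (+ 1 ℤ.+ ((+ 2 ℤ.+ P) ℤ.+ (+ 2 ℤ.+ P))))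
                            ℤ.* (+ 2 ℤ.* (+ 1 ℤ.+ ((+ 3 ℤ.+ P) ℤ.+ (+ 3 ℤ.+ P))))))
      key = ℤ-Solver.solve-∀

    hookSquareSum-5+p :
      hookSquareSum (5 + p) ℤ.* (+ (2 * (5 + p) ∸ 3) ℤ.* + (2 * (5 + p) ∸ 5) ℤ.* + (2 * (5 + p) ∸ 7))
        ≡ (+ (5 + p) ℤ.* + (5 + p) ℤ.- + 9 ℤ.* + (5 + p) ℤ.+ + 23) ℤ.* + ((2 * (5 + p) ∸ 2) C (5 + p ∸ 1))
    hookSquareSum-5+p = begin
      hookSquareSum (5 + p) ℤ.* (+ (2 * (5 + p) ∸ 3) ℤ.* + (2 * (5 + p) ∸ 5) ℤ.* + (2 * (5 + p) ∸ 7))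
        ≡⟨ cong₂ ℤ._*_ (hookSquareSum-closedForm p) odd-factors ⟩
      + 2 ℤ.* (N ℤ.- X) ℤ.* T
        ≡⟨ hookSquareSum-identity ⟩
      Q ℤ.* F
        ≡⟨ cong₂ ℤ._*_ (cong (λ x → x ℤ.* x ℤ.- + 9 ℤ.* x ℤ.+ + 23) (ℤ.pos-+ 5 p)) central-cast ⟨
      (+ (5 + p) ℤ.* + (5 + p) ℤ.- + 9 ℤ.* + (5 + p) ℤ.+ + 23) ℤ.* + ((2 * (5 + p) ∸ 2) C (5 + p ∸ 1))
        ∎
      where
      open ≡-Reasoning
      2[5+p]≡10+[p+p] : ∀ p → 2 * (5 + p) ≡ 10 + (p + p)
      2[5+p]≡10+[p+p] = ℕ-Solver.solve-∀
      [4+p]+[4+p]≡8+[p+p] : ∀ p → (4 + p) + (4 + p) ≡ 8 + (p + p)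
      [4+p]+[4+p]≡8+[p+p] = ℕ-Solver.solve-∀
      cast-odd : ∀ c → + (c + (p + p)) ≡ + c ℤ.+ (P ℤ.+ P)
      cast-odd c = trans (ℤ.pos-+ c (p + p)) (cong (ℤ._+_ (+ c)) (ℤ.pos-+ p p))
      odd-factors : + (2 * (5 + p) ∸ 3) ℤ.* + (2 * (5 + p) ∸ 5) ℤ.* + (2 * (5 + p) ∸ 7) ≡ T
      odd-factors = trans (cong (λ m → + (m ∸ 3) ℤ.* + (m ∸ 5) ℤ.* + (m ∸ 7)) (2[5+p]≡10+[p+p] p))
                          (cong₂ ℤ._*_ (cong₂ ℤ._*_ (cast-odd 7) (cast-odd 5)) (cast-odd 3))
      central-cast : + ((2 * (5 + p) ∸ 2) C (5 + p ∸ 1)) ≡ F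
      central-cast = trans (cong (λ m → + ((m ∸ 2) C (4 + p))) (2[5+p]≡10+[p+p] p))
                           (cong (λ m → + (m C (4 + p))) (sym ([4+p]+[4+p]≡8+[p+p] p)))

open import Data.Integer using (+_; _*_; _+_; _-_)
open import Data.Nat using (ℕ; _≤_; _∸_; suc; s≤s)
open import Data.Nat.Combinatorics using (_C_)
open import Relation.Binary.PropositionalEquality using (_≡_; refl)
open HookCharacterSquares using (hookSquareSum-5+p)

mainTheorem7 : (n : ℕ) → 4 ≤ n →
    hookSquareSum n * (+ (2 Data.Nat.* n ∸ 3) * + (2 Data.Nat.* n ∸ 5) * + (2 Data.Nat.* n ∸ 7))
      ≡ ((+ n * + n - + 9 * + n + + 23) * + ((2 Data.Nat.* n ∸ 2) C (n ∸ 1)))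
mainTheorem7 0                                 ()
mainTheorem7 1                                 (s≤s ())
mainTheorem7 2                                 (s≤s (s≤s ()))
mainTheorem7 3                                 (s≤s (s≤s (s≤s ())))
mainTheorem7 4                                 _ = refl
mainTheorem7 (suc (suc (suc (suc (suc p))))) _ = hookSquareSum-5+p p
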